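{- Let $r$ be a positive integer and let $s,t$ be integers with $0\le s,t\le r-1$. Let $\gamma$ be the fractional part of $(s-\phi^{ -1}(t+1))/r$ (so $0\le\gamma<1$). Let $h$ be the least positive integer with $r<\phi^h$ and $j=\lceil\gamma F_{h+2}\rceil$. If $h$ is even, let $w_L=jF_{h+1}\bmod F_{h+2}$ and $w_H=(j+1)F_{h+1}\bmod F_{h+2}$; if $h$ is odd, let $w_L=jF_h\bmod F_{h+2}$ and $w_H=(j-1)F_h\bmod F_{h+2}$ (least non-negative residues). Let $w=w_L$ if there is an integer $n$ with $\gamma<\phi^{ -1}w_L-n<\gamma+1/r$, and $w=w_H$ otherwise. Put $v=wr+t$ and $u=G(v)$. Then $u$ and $v$ are non-negative integers with $u\equiv s\pmod r$, $v\equiv t\pmod r$, and $u=G(v)$.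
   Context: $F_0=0$, $F_1=1$, $F_i=F_{i-1}+F_{i-2}$ are the Fibonacci numbers and $\phi=(1+\sqrt5)/2$. Hofstadter's G function is $G(x)=\lfloor\phi^{ -1}(x+1)\rfloor$ for integers $x\ge0$ (equivalently $G(0)=0$, $G(1)=1$, $G(x)=x-G(G(x-1))$). -}

module Defs where

open import Data.Bool using (Bool; true; false; if_then_else_; _∧_; T)
open import Data.Nat as ℕ using (ℕ; zero; suc; NonZero; _≤_; _<_; z<s; s<s)
import Data.Nat.Properties as ℕP
open import Data.Integer as ℤ using (ℤ; +_; -_; _≤ᵇ_; _%ℕ_)
open import Data.Product using (Σ; _×_; _,_)
open import Relation.Nullary using (¬_)
open import Relation.Binary.PropositionalEquality using (_≡_)

F : ℕ → ℕ
F zero = 0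
F (suc zero) = 1
F (suc (suc i)) = F (suc i) ℕ.+ F i

F-suc-pos : ∀ i → 0 < F (suc i)
F-suc-pos zero = z<s
F-suc-pos (suc i) = ℕP.<-≤-trans (F-suc-pos i) (ℕP.m≤m+n (F (suc i)) (F i))

instance
  F-ss-nonZero : ∀ {i} → NonZero (F (suc (suc i)))
  F-ss-nonZero {i} = ℕ.>-nonZero (F-suc-pos (suc i))

-- Exact arithmetic in ℤ[φ], φ = (1+√5)/2.
-- An element  ⟨ a , b ⟩  stands for the real number  a + b φ.

record ℤφ : Set where
  constructor ⟨_,_⟩
  field
    a : ℤ
    b : ℤ
open ℤφ public

ι : ℤ → ℤφ
ι n = ⟨ n , + 0 ⟩

ιℕ : ℕ → ℤφ
ιℕ n = ι (+ n)

φ : ℤφ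
φ = ⟨ + 0 , + 1 ⟩

-- φ⁻¹ = φ - 1
φ⁻¹ : ℤφ
φ⁻¹ = ⟨ - (+ 1) , + 1 ⟩

infixl 6 _+φ_ _-φ_
infixl 7 _·φ_

_+φ_ : ℤφ → ℤφ → ℤφ
⟨ a₁ , b₁ ⟩ +φ ⟨ a₂ , b₂ ⟩ = ⟨ a₁ ℤ.+ a₂ , b₁ ℤ.+ b₂ ⟩

_-φ_ : ℤφ → ℤφ → ℤφ
⟨ a₁ , b₁ ⟩ -φ ⟨ a₂ , b₂ ⟩ = ⟨ a₁ ℤ.- a₂ , b₁ ℤ.- b₂ ⟩

_·φ_ : ℤ → ℤφ → ℤφ
n ·φ ⟨ a₁ , b₁ ⟩ = ⟨ n ℤ.* a₁ , n ℤ.* b₁ ⟩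

-- multiplication by φ, using φ² = φ + 1:  (a + bφ)φ = b + (a+b)φ
timesφ : ℤφ → ℤφ
timesφ ⟨ a₁ , b₁ ⟩ = ⟨ b₁ , a₁ ℤ.+ b₁ ⟩

φ^ : ℕ → ℤφ
φ^ zero = ι (+ 1)
φ^ (suc h) = timesφ (φ^ h)

-- Positivity test:  a + bφ > 0  ⇔  p + q√5 > 0  with p = 2a + b, q = b.
-- p + q√5 > 0 iff
--   (p ≥ 0, q ≥ 0, p + q > 0)  or  (p ≥ 0, q < 0, 5q² < p²)  or  (p < 0, q > 0, p² < 5q²).
infix 4 _<ᵇ_
_<ᵇ_ : ℤ → ℤ → Bool
x <ᵇ y = (x ℤ.+ + 1) ≤ᵇ y

posᵇ : ℤφ → Bool
posᵇ ⟨ a₁ , b₁ ⟩ =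
  let p = + 2 ℤ.* a₁ ℤ.+ b₁
      q = b₁
  in if (+ 0 ≤ᵇ p) ∧ (+ 0 ≤ᵇ q) then (+ 0 <ᵇ (p ℤ.+ q))
     else if (+ 0 ≤ᵇ p) then (+ 5 ℤ.* q ℤ.* q <ᵇ p ℤ.* p)
     else if (+ 0 <ᵇ q) then (p ℤ.* p <ᵇ + 5 ℤ.* q ℤ.* q)
     else false

infix 4 _<φ_ _≤φ_
_<φ_ : ℤφ → ℤφ → Set
x <φ y = T (posᵇ (y -φ x))

_≤φ_ : ℤφ → ℤφ → Set
x ≤φ y = ¬ (y <φ x)

-- Hofstadter's G:  G x = ⌊ φ⁻¹ (x + 1) ⌋, the greatest natural g with
-- g ≤ φ⁻¹(x+1)  (necessarily g ≤ x + 1, so a downward search suffices).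

greatestBelow : (ℕ → Bool) → ℕ → ℕ
greatestBelow P zero = zero
greatestBelow P (suc n) = if P (suc n) then suc n else greatestBelow P n

G : ℕ → ℕ
G x = greatestBelow (λ g → if posᵇ (ιℕ g -φ (+ (suc x)) ·φ φ⁻¹) then false else true) (suc x)

-- r·γ where γ = (s - φ⁻¹(t+1))/r - k  (k the candidate floor)
rγ : ℕ → ℕ → ℕ → ℤ → ℤφ
rγ r s t k = (ιℕ s -φ (+ (suc t)) ·φ φ⁻¹) -φ ι (k ℤ.* + r)

isEven : ℕ → Bool
isEven zero = true
isEven (suc zero) = false
isEven (suc (suc n)) = isEven n

modF : ℕ → ℤ → ℕ
modF h x = _%ℕ_ x (F (suc (suc h))) {{F-ss-nonZero {h}}}

wL : ℕ → ℤ → ℕ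
wL h j = if isEven h then modF h (j ℤ.* + F (suc h)) else modF h (j ℤ.* + F h)

wH : ℕ → ℤ → ℕ
wH h j = if isEven h then modF h ((j ℤ.+ + 1) ℤ.* + F (suc h)) else modF h ((j ℤ.- + 1) ℤ.* + F h)

-- ∃ n ∈ ℤ, γ < φ⁻¹ w - n < γ + 1/r   (multiplied through by r > 0, Γ = rγ)
LowCond : ℕ → ℤφ → ℕ → Set
LowCond r Γ w = Σ ℤ λ n →
  (Γ <φ (+ r) ·φ ((+ w) ·φ φ⁻¹ -φ ι n)) × ((+ r) ·φ ((+ w) ·φ φ⁻¹ -φ ι n) <φ Γ +φ ι (+ 1))

Conclusion : (r s t : ℕ) → .{{NonZero r}} → ℕ → Set
Conclusion r s t w =
  let v = w ℕ.* r ℕ.+ t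
      u = G v
  in (u ℕ.% r ≡ s ℕ.% r) × (v ℕ.% r ≡ t ℕ.% r) × (u ≡ G v)

{-# OPTIONS --safe #-}
-- Write A, B, C for F h, F (h + 1), F (h + 2) and β for φ^-(h+2).  By Cassini's identity
-- B² - AC = (-1)ʰ, the residue w of μB modulo C (h even) satisfies C(wφ⁻¹ - n) = μ - wβ for some
-- integer n, and the residue w of mA modulo C (h odd) satisfies C(wφ⁻¹ - n) = m + wβ.  So the
-- condition on w says that r(μ - wβ), resp. r(m + wβ), lies in the window (CΓ, CΓ + C), Γ = rγ.
-- The bounds on j put the value for wL below the upper end of the window and the value for wH
-- above its lower end (for odd h the other way round).  Since C - r - rAβ = C(1 - rφ⁻ʰ) > 0,
-- the two values differ by less than the width C, so if wL misses the window then wH lies in it.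
-- Finally the condition on w says that (v + 1)φ⁻¹ lies strictly between M = s + (n - k)r and
-- M + 1, whence u = G v = M ≡ s (mod r).
--
-- All comparisons of reals are made exactly in ℤ[φ], where x > 0 iff φⁿx has natural
-- coordinates for some n; this agrees with the test posᵇ of the statement.
module Submission where

open import Defs

module _ where
  open import Data.Bool using (Bool; true; false; T; if_then_else_; _∧_)
  open import Data.Empty using (⊥; ⊥-elim)
  open import Data.Integer as ℤ using (ℤ; +_; -[1+_]; -_; _+_; _-_; _*_; _⊖_)
  import Data.Integer.Properties as ℤP
  import Data.Integer.DivMod as ℤD
  open import Data.Integer.Tactic.RingSolver using (solve-∀)
  open import Data.Nat as ℕ using (ℕ; zero; suc; NonZero; z≤n; s≤s)
  import Data.Nat.Properties as ℕP
  import Data.Nat.DivMod as ℕD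
  open import Data.Product using (Σ; _×_; _,_; proj₁; proj₂)
  open import Data.Sum using (_⊎_; inj₁; inj₂; [_,_]′; map₂)
  open import Function using (_∘_)
  open import Relation.Nullary using (¬_; yes; no)
  open import Relation.Nullary.Decidable using (T?)
  open import Relation.Binary.PropositionalEquality
    using (_≡_; _≢_; refl; sym; trans; cong; cong₂; subst; subst₂; module ≡-Reasoning)

  IsNat IsNat⁺ : ℤ → Set
  IsNat x = Σ ℕ λ n → x ≡ + n
  IsNat⁺ x = Σ ℕ λ n → x ≡ + suc n

  IsNat⁺⇒IsNat : ∀ {x} → IsNat⁺ x → IsNat x
  IsNat⁺⇒IsNat (n , refl) = suc n , refl

  IsNat⁺-pos : ∀ {n} → 0 ℕ.< n → IsNat⁺ (+ n)
  IsNat⁺-pos {suc n} _ = n , refl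

  IsNat-∸ : ∀ {m n} → n ℕ.≤ m → IsNat (+ m - + n)
  IsNat-∸ {m} {n} n≤m = m ℕ.∸ n , trans (ℤP.[+m]-[+n]≡m⊖n m n) (ℤP.≤-⊖ n≤m)

  IsNat⁺-∸ : ∀ {m n} → n ℕ.< m → IsNat⁺ (+ m - + n)
  IsNat⁺-∸ {m} {n} n<m = m ℕ.∸ suc n , trans (ℤP.[+m]-[+n]≡m⊖n m n) (trans (ℤP.≤-⊖ (ℕP.<⇒≤ n<m)) (cong +_ (ℕP.+-∸-assoc 1 n<m)))

  IsNat⁺[x+1]⇒IsNat : ∀ {x} → IsNat⁺ (x + + 1) → IsNat x
  IsNat⁺[x+1]⇒IsNat {+ m} _ = m , refl
  IsNat⁺[x+1]⇒IsNat { -[1+ zero ]} (_ , ())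
  IsNat⁺[x+1]⇒IsNat { -[1+ suc _ ]} (_ , ())

  IsNat⁺⇒IsNat[x-1] : ∀ {x} → IsNat⁺ x → IsNat (x - + 1)
  IsNat⁺⇒IsNat[x-1] (n , refl) = n , refl

  IsNat-+ : ∀ {x y} → IsNat x → IsNat y → IsNat (x + y)
  IsNat-+ (m , refl) (n , refl) = m ℕ.+ n , refl

  IsNat⁺-+ : ∀ {x y} → IsNat⁺ x → IsNat y → IsNat⁺ (x + y)
  IsNat⁺-+ (m , refl) (n , refl) = m ℕ.+ n , refl

  IsNat-* : ∀ {x y} → IsNat x → IsNat y → IsNat (x * y)
  IsNat-* (m , refl) (n , refl) = m ℕ.* n , sym (ℤP.pos-* m n)

  IsNat⁺-* : ∀ {x y} → IsNat⁺ x → IsNat⁺ y → IsNat⁺ (x * y)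
  IsNat⁺-* (m , refl) (n , refl) = n ℕ.+ m ℕ.* suc n , sym (ℤP.pos-* (suc m) (suc n))

  IsNat⁺-cancel : ∀ k {x} → IsNat⁺ (+ suc k * x) → IsNat⁺ x
  IsNat⁺-cancel k {+ suc m} _ = m , refl
  IsNat⁺-cancel k {+ zero} (n , eq) with trans (sym (ℤP.*-zeroʳ (+ suc k))) eq
  ... | ()
  IsNat⁺-cancel k { -[1+ m ]} (n , ())

  IsNat⊎IsNat⁺-neg : ∀ x → IsNat x ⊎ IsNat⁺ (- x)
  IsNat⊎IsNat⁺-neg (+ n) = inj₁ (n , refl)
  IsNat⊎IsNat⁺-neg -[1+ n ] = inj₂ (n , refl)

  IsNat⁺-IsNat-sum≢0 : ∀ {x y} → IsNat⁺ x → IsNat y → x + y ≢ + 0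
  IsNat⁺-IsNat-sum≢0 (m , refl) (n , refl) ()

  IsNat-multiple : ∀ {c d x} → IsNat c → c * d ≡ x → IsNat⁺ (x + c) → IsNat x
  IsNat-multiple {c} {d} {x} c≥0 cd≡x x+c>0 with IsNat⊎IsNat⁺-neg d
  ... | inj₁ d≥0 = subst IsNat cd≡x (IsNat-* c≥0 d≥0)
  ... | inj₂ -d>0 = ⊥-elim (IsNat⁺-IsNat-sum≢0 x+c>0 (IsNat-* c≥0 (IsNat⁺⇒IsNat[x-1] -d>0))
                      (trans (cong (λ y → y + c + c * (- d - + 1)) (sym cd≡x)) (identity c d)))
    where
    identity : ∀ c d → c * d + c + c * (- d - + 1) ≡ + 0
    identity = solve-∀

  -- Arithmetic in ℤ[φ]
  ℤφ-≡ : ∀ {x y} → a x ≡ a y → b x ≡ b y → x ≡ y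
  ℤφ-≡ = cong₂ ⟨_,_⟩

  0φ 1φ : ℤφ
  0φ = ι (+ 0)
  1φ = ι (+ 1)

  ι≡·1φ : ∀ m → ι m ≡ m ·φ 1φ
  ι≡·1φ m = ℤφ-≡ (sym (ℤP.*-identityʳ m)) (sym (ℤP.*-zeroʳ m))

  negφ : ℤφ → ℤφ
  negφ x = ⟨ - a x , - b x ⟩

  negφ-−φ : ∀ x y → negφ (y -φ x) ≡ x -φ y
  negφ-−φ x y = ℤφ-≡ (identity (a x) (a y)) (identity (b x) (b y))
    where
    identity : ∀ u v → - (v - u) ≡ u - v
    identity = solve-∀

  +φ-identityˡ : ∀ x → 0φ +φ x ≡ x
  +φ-identityˡ x = ℤφ-≡ (ℤP.+-identityˡ (a x)) (ℤP.+-identityˡ (b x))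

  +φ-identityʳ : ∀ x → x +φ 0φ ≡ x
  +φ-identityʳ x = ℤφ-≡ (ℤP.+-identityʳ (a x)) (ℤP.+-identityʳ (b x))

  timesφ^ : ℕ → ℤφ → ℤφ
  timesφ^ zero x = x
  timesφ^ (suc n) x = timesφ (timesφ^ n x)

  timesφ^-commute : (f : ℤφ → ℤφ) → (∀ x → timesφ (f x) ≡ f (timesφ x)) →
                    ∀ n x → timesφ^ n (f x) ≡ f (timesφ^ n x)
  timesφ^-commute f comm zero x = refl
  timesφ^-commute f comm (suc n) x = trans (cong timesφ (timesφ^-commute f comm n x)) (comm _)

  timesφ^-+φ : ∀ n x y → timesφ^ n (x +φ y) ≡ timesφ^ n x +φ timesφ^ n y
  timesφ^-+φ zero x y = refl
  timesφ^-+φ (suc n) x y = trans (cong timesφ (timesφ^-+φ n x y)) (timesφ-+φ (timesφ^ n x) (timesφ^ n y))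
    where
    timesφ-+φ : ∀ x y → timesφ (x +φ y) ≡ timesφ x +φ timesφ y
    timesφ-+φ x y = cong ⟨ b x + b y ,_⟩ (lemma (a x) (b x) (a y) (b y))
      where
      lemma : ∀ p q p′ q′ → p + p′ + (q + q′) ≡ p + q + (p′ + q′)
      lemma = solve-∀

  timesφ^-negφ : ∀ n x → timesφ^ n (negφ x) ≡ negφ (timesφ^ n x)
  timesφ^-negφ = timesφ^-commute negφ λ x → cong ⟨ - b x ,_⟩ (sym (ℤP.neg-distrib-+ (a x) (b x)))

  timesφ^-·φ : ∀ c n x → timesφ^ n (c ·φ x) ≡ c ·φ timesφ^ n x
  timesφ^-·φ c = timesφ^-commute (c ·φ_) λ x → cong ⟨ c * b x ,_⟩ (sym (ℤP.*-distribˡ-+ c (a x) (b x)))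

  timesφ^-+ : ∀ k n x → timesφ^ (k ℕ.+ n) x ≡ timesφ^ k (timesφ^ n x)
  timesφ^-+ zero n x = refl
  timesφ^-+ (suc k) n x = cong timesφ (timesφ^-+ k n x)

  -- Positivity in ℤ[φ]
  data NatCoords⁺ : ℤφ → Set where
    natCoords⁺ : ∀ m n → 1 ℕ.≤ m ℕ.+ n → NatCoords⁺ ⟨ + m , + n ⟩

  NatCoords⁺-timesφ : ∀ {x} → NatCoords⁺ x → NatCoords⁺ (timesφ x)
  NatCoords⁺-timesφ (natCoords⁺ m n 1≤m+n) =
    natCoords⁺ n (m ℕ.+ n) (ℕP.≤-trans 1≤m+n (ℕP.m≤n+m (m ℕ.+ n) n))

  NatCoords⁺-+φ : ∀ {x y} → NatCoords⁺ x → NatCoords⁺ y → NatCoords⁺ (x +φ y)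
  NatCoords⁺-+φ (natCoords⁺ m n 1≤m+n) (natCoords⁺ m′ n′ _) =
    natCoords⁺ (m ℕ.+ m′) (n ℕ.+ n′) (ℕP.≤-trans 1≤m+n (ℕP.+-mono-≤ (ℕP.m≤m+n m m′) (ℕP.m≤m+n n n′)))

  NatCoords⁺-·φ : ∀ k {x} → NatCoords⁺ x → NatCoords⁺ (+ suc k ·φ x)
  NatCoords⁺-·φ k (natCoords⁺ m n 1≤m+n) =
    subst₂ (λ p q → NatCoords⁺ ⟨ p , q ⟩) (ℤP.pos-* (suc k) m) (ℤP.pos-* (suc k) n)
      (natCoords⁺ (suc k ℕ.* m) (suc k ℕ.* n)
        (ℕP.≤-trans 1≤m+n (ℕP.≤-trans (ℕP.m≤n*m (m ℕ.+ n) (suc k) {{_}}) (ℕP.≤-reflexive (ℕP.*-distribˡ-+ (suc k) m n)))))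

  NatCoords⁺-asym : ∀ {x} → NatCoords⁺ x → ¬ NatCoords⁺ (negφ x)
  NatCoords⁺-asym (natCoords⁺ zero zero ())
  NatCoords⁺-asym (natCoords⁺ zero (suc n) _) ()
  NatCoords⁺-asym (natCoords⁺ (suc m) n _) ()

  -- φⁿ(a + bφ) = (aF(n-1) + bF(n)) + (aF(n) + bF(n+1))φ: for large n both coordinates
  -- have the sign of a + bφ.
  Positive : ℤφ → Set
  Positive x = Σ ℕ λ n → NatCoords⁺ (timesφ^ n x)

  NatCoords⁺-raise : ∀ k {n x} → NatCoords⁺ (timesφ^ n x) → NatCoords⁺ (timesφ^ (k ℕ.+ n) x)
  NatCoords⁺-raise k {n} {x} h = subst NatCoords⁺ (sym (timesφ^-+ k n x)) (iterate k h)
    where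
    iterate : ∀ k {y} → NatCoords⁺ y → NatCoords⁺ (timesφ^ k y)
    iterate zero h = h
    iterate (suc k) h = NatCoords⁺-timesφ (iterate k h)

  Positive-+φ : ∀ {x y} → Positive x → Positive y → Positive (x +φ y)
  Positive-+φ {x} {y} (m , hx) (n , hy) =
    n ℕ.+ m , subst NatCoords⁺ (sym (timesφ^-+φ (n ℕ.+ m) x y))
                (NatCoords⁺-+φ (NatCoords⁺-raise n hx)
                  (subst (λ i → NatCoords⁺ (timesφ^ i y)) (ℕP.+-comm m n) (NatCoords⁺-raise m hy)))

  Positive-·φ : ∀ {c x} → IsNat⁺ c → Positive x → Positive (c ·φ x)
  Positive-·φ {x = x} (k , refl) (n , h) = n , subst NatCoords⁺ (sym (timesφ^-·φ (+ suc k) n x)) (NatCoords⁺-·φ k h)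

  Positive-timesφ^⁻¹ : ∀ k {x} → Positive (timesφ^ k x) → Positive x
  Positive-timesφ^⁻¹ k {x} (n , h) = n ℕ.+ k , subst NatCoords⁺ (sym (timesφ^-+ n k x)) h

  Positive-asym : ∀ {x} → Positive x → ¬ Positive (negφ x)
  Positive-asym {x} (m , hx) (n , hy) =
    NatCoords⁺-asym (NatCoords⁺-raise n hx)
      (subst NatCoords⁺ (timesφ^-negφ (n ℕ.+ m) x)
        (subst (λ i → NatCoords⁺ (timesφ^ i (negφ x))) (ℕP.+-comm m n) (NatCoords⁺-raise m hy)))

  ¬Positive-0φ : ¬ Positive 0φ
  ¬Positive-0φ p = Positive-asym p p

  Positive-ι⇒IsNat⁺ : ∀ {z} → Positive (ι z) → IsNat⁺ z
  Positive-ι⇒IsNat⁺ {+ zero} z>0 = ⊥-elim (¬Positive-0φ z>0)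
  Positive-ι⇒IsNat⁺ {+ suc n} _ = n , refl
  Positive-ι⇒IsNat⁺ { -[1+ n ]} z>0 = ⊥-elim (Positive-asym z>0 (0 , natCoords⁺ (suc n) 0 (s≤s z≤n)))

  -- Euclid's algorithm on the coordinates: multiplying by φ shrinks |a| + |b| while the signs are mixed.
  mixedSign : ∀ fuel m n → m ℕ.+ n ℕ.< fuel →
              Positive ⟨ + suc m , -[1+ n ] ⟩ ⊎ Positive (negφ ⟨ + suc m , -[1+ n ] ⟩)
  mixedSign (suc fuel) m n m+n<fuel with m ℕP.≤? n
  ... | yes m≤n = inj₂ (1 , subst (λ q → NatCoords⁺ ⟨ + suc n , q ⟩) (sym (ℤP.≤-⊖ (s≤s m≤n)))
                              (natCoords⁺ (suc n) (n ℕ.∸ m) (s≤s z≤n)))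
  ... | no m≰n = descend (ℕP.≰⇒> m≰n)
    where
    descend : n ℕ.< m → Positive ⟨ + suc m , -[1+ n ] ⟩ ⊎ Positive (negφ ⟨ + suc m , -[1+ n ] ⟩)
    descend n<m = recurse (mixedSign fuel n d (ℕP.<-≤-trans (ℕP.+-monoʳ-< n d<m) m+n≤fuel))
      where
      d : ℕ
      d = m ℕ.∸ suc n
      m∸n≡1+d : suc m ℕ.∸ suc n ≡ suc d
      m∸n≡1+d = ℕP.+-∸-assoc 1 n<m
      d<m : d ℕ.< m
      d<m = subst (ℕ._≤ m) m∸n≡1+d (ℕP.m∸n≤m m n)
      m+n≤fuel : n ℕ.+ m ℕ.≤ fuel
      m+n≤fuel = ℕP.≤-pred (subst (ℕ._< suc fuel) (ℕP.+-comm m n) m+n<fuel)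
      timesφ-coord : suc m ⊖ suc n ≡ + suc d
      timesφ-coord = trans (ℤP.⊖-≥ (s≤s (ℕP.<⇒≤ n<m))) (cong +_ m∸n≡1+d)
      recurse : Positive ⟨ + suc n , -[1+ d ] ⟩ ⊎ Positive (negφ ⟨ + suc n , -[1+ d ] ⟩) →
                Positive ⟨ + suc m , -[1+ n ] ⟩ ⊎ Positive (negφ ⟨ + suc m , -[1+ n ] ⟩)
      recurse (inj₁ p) = inj₂ (Positive-timesφ^⁻¹ 1
                         (subst (Positive ∘ ⟨ + suc n ,_⟩) (sym (trans (ℤP.⊖-swap (suc n) (suc m)) (cong -_ timesφ-coord))) p))
      recurse (inj₂ p) = inj₁ (Positive-timesφ^⁻¹ 1 (subst (Positive ∘ ⟨ -[1+ n ] ,_⟩) (sym timesφ-coord) p))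

  trichotomy : ∀ x → Positive x ⊎ x ≡ 0φ ⊎ Positive (negφ x)
  trichotomy ⟨ + zero , + zero ⟩ = inj₂ (inj₁ refl)
  trichotomy ⟨ + zero , + suc n ⟩ = inj₁ (0 , natCoords⁺ 0 (suc n) (s≤s z≤n))
  trichotomy ⟨ + suc m , + n ⟩ = inj₁ (0 , natCoords⁺ (suc m) n (s≤s z≤n))
  trichotomy ⟨ + zero , -[1+ n ] ⟩ = inj₂ (inj₂ (0 , natCoords⁺ 0 (suc n) (s≤s z≤n)))
  trichotomy ⟨ -[1+ m ] , + zero ⟩ = inj₂ (inj₂ (0 , natCoords⁺ (suc m) 0 (s≤s z≤n)))
  trichotomy ⟨ -[1+ m ] , -[1+ n ] ⟩ = inj₂ (inj₂ (0 , natCoords⁺ (suc m) (suc n) (s≤s z≤n)))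
  trichotomy ⟨ + suc m , -[1+ n ] ⟩ = map₂ inj₂ (mixedSign _ m n ℕP.≤-refl)
  trichotomy ⟨ -[1+ m ] , + suc n ⟩ = [ inj₂ ∘ inj₂ , inj₁ ]′ (mixedSign _ m n ℕP.≤-refl)

  NonNegative : ℤφ → Set
  NonNegative x = Positive x ⊎ x ≡ 0φ

  Positive-+φ-NonNegative : ∀ {x y} → Positive x → NonNegative y → Positive (x +φ y)
  Positive-+φ-NonNegative x>0 (inj₁ y>0) = Positive-+φ x>0 y>0
  Positive-+φ-NonNegative {x} x>0 (inj₂ refl) = subst Positive (sym (+φ-identityʳ x)) x>0

  NonNegative-+φ-Positive : ∀ {x y} → NonNegative x → Positive y → Positive (x +φ y)
  NonNegative-+φ-Positive (inj₁ x>0) y>0 = Positive-+φ x>0 y>0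
  NonNegative-+φ-Positive {y = y} (inj₂ refl) y>0 = subst Positive (sym (+φ-identityˡ y)) y>0

  NonNegative-·φ : ∀ {c x} → IsNat c → Positive x → NonNegative (c ·φ x)
  NonNegative-·φ (zero , refl) _ = inj₂ refl
  NonNegative-·φ (suc k , refl) x>0 = inj₁ (Positive-·φ (k , refl) x>0)

  NonNegative-ι : ∀ {z} → IsNat z → NonNegative (ι z)
  NonNegative-ι (zero , refl) = inj₂ refl
  NonNegative-ι (suc n , refl) = inj₁ (0 , natCoords⁺ (suc n) 0 (s≤s z≤n))

  Positive-·φ⁻¹ : ∀ {c x} → IsNat⁺ c → Positive (c ·φ x) → Positive x
  Positive-·φ⁻¹ {c} {x} c>0 cx>0 with trichotomy x
  ... | inj₁ x>0 = x>0
  ... | inj₂ (inj₁ refl) = ⊥-elim (¬Positive-0φ (subst Positive (ℤφ-≡ (ℤP.*-zeroʳ c) (ℤP.*-zeroʳ c)) cx>0))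
  ... | inj₂ (inj₂ -x>0) = ⊥-elim (Positive-asym cx>0 (subst Positive (sym (ℤφ-≡ (ℤP.neg-distribʳ-* c (a x)) (ℤP.neg-distribʳ-* c (b x))))
                                                                (Positive-·φ c>0 -x>0)))

  -- The test posᵇ
  -- posᵇ ⟨ a , b ⟩ unfolds to √5-test (2a + b) b, which decides (2a + b) + b√5 > 0.
  √5-test : ℤ → ℤ → Bool
  √5-test p q =
    if (+ 0 ℤ.≤ᵇ p) ∧ (+ 0 ℤ.≤ᵇ q) then (+ 0 <ᵇ (p + q))
    else if (+ 0 ℤ.≤ᵇ p) then (+ 5 * q * q <ᵇ p * p)
    else if (+ 0 <ᵇ q) then (p * p <ᵇ + 5 * q * q)
    else false

  data √5-Positive (p q : ℤ) : Set where
    both-nonneg : IsNat p → IsNat q → IsNat⁺ (p + q) → √5-Positive p q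
    p-dominant : IsNat p → IsNat⁺ (- q) → IsNat⁺ (p * p - + 5 * q * q) → √5-Positive p q
    q-dominant : IsNat⁺ (- p) → IsNat⁺ q → IsNat⁺ (+ 5 * q * q - p * p) → √5-Positive p q

  0≤ᵇ-true : ∀ {x} → (+ 0 ℤ.≤ᵇ x) ≡ true → IsNat x
  0≤ᵇ-true {+ n} _ = n , refl

  0≤ᵇ-false : ∀ {x} → (+ 0 ℤ.≤ᵇ x) ≡ false → IsNat⁺ (- x)
  0≤ᵇ-false { -[1+ n ]} _ = n , refl

  IsNat⇒0≤ᵇ : ∀ {x} → IsNat x → (+ 0 ℤ.≤ᵇ x) ≡ true
  IsNat⇒0≤ᵇ (n , refl) = refl

  IsNat⁺-neg⇒0≤ᵇ : ∀ {x} → IsNat⁺ (- x) → (+ 0 ℤ.≤ᵇ x) ≡ false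
  IsNat⁺-neg⇒0≤ᵇ { -[1+ _ ]} _ = refl
  IsNat⁺-neg⇒0≤ᵇ {+ zero} (_ , ())
  IsNat⁺-neg⇒0≤ᵇ {+ suc _} (_ , ())

  <ᵇ⇒IsNat⁺ : ∀ x y → T (x <ᵇ y) → IsNat⁺ (y - x)
  <ᵇ⇒IsNat⁺ x y x<y =
    ℤ.∣ y - (x + + 1) ∣ ,
    trans (difference x y) (cong (λ z → + 1 + z) (sym (ℤP.0≤i⇒+∣i∣≡i (ℤP.i≤j⇒0≤j-i (ℤP.≤ᵇ⇒≤ {x + + 1} {y} x<y)))))
    where
    difference : ∀ x y → y - x ≡ + 1 + (y - (x + + 1))
    difference = solve-∀

  IsNat⁺⇒<ᵇ : ∀ x y → IsNat⁺ (y - x) → T (x <ᵇ y)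
  IsNat⁺⇒<ᵇ x y (n , y-x≡1+n) =
    ℤP.≤⇒≤ᵇ (ℤP.0≤i-j⇒j≤i {y} {x + + 1} (subst (+ 0 ℤ.≤_) (sym (trans (difference x y) (cong (λ z → z - + 1) y-x≡1+n))) (ℤ.+≤+ z≤n)))
    where
    difference : ∀ x y → y - (x + + 1) ≡ y - x - + 1
    difference = solve-∀

  √5-test-sound : ∀ p q → T (√5-test p q) → √5-Positive p q
  √5-test-sound p q h with + 0 ℤ.≤ᵇ p in p≥0 | + 0 ℤ.≤ᵇ q in q≥0
  ... | true | true = both-nonneg (0≤ᵇ-true p≥0) (0≤ᵇ-true q≥0) (subst IsNat⁺ (ℤP.+-identityʳ (p + q)) (<ᵇ⇒IsNat⁺ (+ 0) (p + q) h))
  ... | true | false = p-dominant (0≤ᵇ-true p≥0) (0≤ᵇ-false q≥0) (<ᵇ⇒IsNat⁺ (+ 5 * q * q) (p * p) h)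
  ... | false | _ with + 0 <ᵇ q in q>0
  ...   | true = q-dominant (0≤ᵇ-false p≥0) (subst IsNat⁺ (ℤP.+-identityʳ q) (<ᵇ⇒IsNat⁺ (+ 0) q (subst T (sym q>0) _)))
                   (<ᵇ⇒IsNat⁺ (p * p) (+ 5 * q * q) h)

  √5-test-complete : ∀ p q → √5-Positive p q → T (√5-test p q)
  √5-test-complete p q (both-nonneg p≥0 q≥0 p+q>0) rewrite IsNat⇒0≤ᵇ p≥0 | IsNat⇒0≤ᵇ q≥0 =
    IsNat⁺⇒<ᵇ (+ 0) (p + q) (subst IsNat⁺ (sym (ℤP.+-identityʳ (p + q))) p+q>0)
  √5-test-complete p q (p-dominant p≥0 q<0 norm>0) rewrite IsNat⇒0≤ᵇ p≥0 | IsNat⁺-neg⇒0≤ᵇ q<0 =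
    IsNat⁺⇒<ᵇ (+ 5 * q * q) (p * p) norm>0
  √5-test-complete p q (q-dominant p<0 (n , refl) norm<0) rewrite IsNat⁺-neg⇒0≤ᵇ p<0 =
    IsNat⁺⇒<ᵇ (p * p) (+ 5 * q * q) norm<0

  -- φ (p + qφ) = q + (p + q)φ
  √5-Positive-timesφ⁻¹ : ∀ p q → √5-Positive (+ 2 * q + (p + q)) (p + q) → √5-Positive (+ 2 * p + q) q
  √5-Positive-timesφ⁻¹ p q (both-nonneg P′≥0 Q′≥0 P′+Q′>0) with IsNat⊎IsNat⁺-neg q | IsNat⊎IsNat⁺-neg (+ 2 * p + q)
  ... | inj₁ q≥0 | inj₁ P≥0 =
    both-nonneg P≥0 q≥0 (IsNat⁺-cancel 2 (subst IsNat⁺ (identity p q) (IsNat⁺-+ P′+Q′>0 (IsNat-* (2 , refl) P≥0))))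
    where
    identity : ∀ p q → + 2 * q + (p + q) + (p + q) + + 2 * (+ 2 * p + q) ≡ + 3 * (+ 2 * p + q + q)
    identity = solve-∀
  ... | inj₁ q≥0 | inj₂ P<0 =
    q-dominant P<0 q>0 (subst IsNat⁺ (identity p q) (IsNat⁺-+ (IsNat⁺-* (3 , refl) (IsNat⁺-* q>0 q>0))
                                                             (IsNat-* (IsNat-* (2 , refl) Q′≥0) (IsNat⁺⇒IsNat (IsNat⁺-+ q>0 (IsNat⁺⇒IsNat P<0))))))
    where
    q>0 : IsNat⁺ q
    q>0 = subst IsNat⁺ (q≡ p q) (IsNat⁺-+ P<0 (IsNat-* (2 , refl) Q′≥0))
      where
      q≡ : ∀ p q → - (+ 2 * p + q) + + 2 * (p + q) ≡ q
      q≡ = solve-∀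
    identity : ∀ p q → + 4 * (q * q) + + 2 * (p + q) * (q + - (+ 2 * p + q)) ≡ + 5 * q * q - (+ 2 * p + q) * (+ 2 * p + q)
    identity = solve-∀
  ... | inj₂ q<0 | _ =
    p-dominant (subst IsNat (P≡ p q) (IsNat-+ (IsNat-* (2 , refl) P′≥0) (IsNat-* (5 , refl) (IsNat⁺⇒IsNat q<0)))) q<0
      (subst IsNat⁺ (identity p q) (IsNat⁺-+ (IsNat⁺-* (19 , refl) (IsNat⁺-* q<0 q<0))
                                             (IsNat-+ (IsNat-* (IsNat-* (4 , refl) P′≥0) P′≥0) (IsNat-* (IsNat-* (20 , refl) P′≥0) (IsNat⁺⇒IsNat q<0)))))
    where
    P≡ : ∀ p q → + 2 * (+ 2 * q + (p + q)) + + 5 * - q ≡ + 2 * p + q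
    P≡ = solve-∀
    identity : ∀ p q → + 20 * (- q * - q) + (+ 4 * (+ 2 * q + (p + q)) * (+ 2 * q + (p + q)) + + 20 * (+ 2 * q + (p + q)) * - q)
                       ≡ (+ 2 * p + q) * (+ 2 * p + q) - + 5 * q * q
    identity = solve-∀
  √5-Positive-timesφ⁻¹ p q (p-dominant P′≥0 Q′<0 norm′>0) =
    q-dominant (subst IsNat⁺ (-P≡ p q) (IsNat⁺-+ (IsNat⁺-* (1 , refl) Q′<0) (IsNat⁺⇒IsNat q>0))) q>0
      (subst IsNat⁺ (norm≡ p q) norm′>0)
    where
    q>0 : IsNat⁺ q
    q>0 = IsNat⁺-cancel 1 (subst IsNat⁺ (2q≡ p q) (IsNat⁺-+ Q′<0 P′≥0))
      where
      2q≡ : ∀ p q → - (p + q) + (+ 2 * q + (p + q)) ≡ + 2 * q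
      2q≡ = solve-∀
    -P≡ : ∀ p q → + 2 * - (p + q) + q ≡ - (+ 2 * p + q)
    -P≡ = solve-∀
    norm≡ : ∀ p q → (+ 2 * q + (p + q)) * (+ 2 * q + (p + q)) - + 5 * (p + q) * (p + q)
                   ≡ + 5 * q * q - (+ 2 * p + q) * (+ 2 * p + q)
    norm≡ = solve-∀
  √5-Positive-timesφ⁻¹ p q (q-dominant P′<0 Q′>0 norm′<0) =
    p-dominant (IsNat⁺⇒IsNat (subst IsNat⁺ (P≡ p q) (IsNat⁺-+ (IsNat⁺-* (1 , refl) Q′>0) (IsNat⁺⇒IsNat q<0)))) q<0
      (subst IsNat⁺ (norm≡ p q) norm′<0)
    where
    q<0 : IsNat⁺ (- q)
    q<0 = IsNat⁺-cancel 1 (subst IsNat⁺ (-2q≡ p q) (IsNat⁺-+ P′<0 (IsNat⁺⇒IsNat Q′>0)))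
      where
      -2q≡ : ∀ p q → - (+ 2 * q + (p + q)) + (p + q) ≡ + 2 * - q
      -2q≡ = solve-∀
    P≡ : ∀ p q → + 2 * (p + q) + - q ≡ + 2 * p + q
    P≡ = solve-∀
    norm≡ : ∀ p q → + 5 * (p + q) * (p + q) - (+ 2 * q + (p + q)) * (+ 2 * q + (p + q))
                   ≡ (+ 2 * p + q) * (+ 2 * p + q) - + 5 * q * q
    norm≡ = solve-∀

  √5-Positive-asym : ∀ {p q} → √5-Positive p q → ¬ √5-Positive (- p) (- q)
  √5-Positive-asym {p} {q} (both-nonneg _ _ p+q>0) (both-nonneg -p≥0 -q≥0 _) =
    IsNat⁺-IsNat-sum≢0 p+q>0 (IsNat-+ -p≥0 -q≥0) (identity p q)
    where
    identity : ∀ p q → p + q + (- p + - q) ≡ + 0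
    identity = solve-∀
  √5-Positive-asym {q = q} (both-nonneg (zero , refl) q≥0 _) (p-dominant _ _ norm>0) =
    IsNat⁺-IsNat-sum≢0 norm>0 (IsNat-* (IsNat-* (5 , refl) q≥0) q≥0) (identity q)
    where
    identity : ∀ q → - + 0 * - + 0 - + 5 * - q * - q + + 5 * q * q ≡ + 0
    identity = solve-∀
  √5-Positive-asym {q = q} (both-nonneg _ q≥0 _) (q-dominant _ -q>0 _) =
    IsNat⁺-IsNat-sum≢0 -q>0 q≥0 (ℤP.+-inverseˡ q)
  √5-Positive-asym {q = q} (p-dominant (zero , refl) -q>0 norm>0) (both-nonneg _ _ _) =
    IsNat⁺-IsNat-sum≢0 norm>0 (IsNat-* (IsNat-* (5 , refl) -q≥0) -q≥0) (identity q)
    where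
    -q≥0 = IsNat⁺⇒IsNat -q>0
    identity : ∀ q → + 0 * + 0 - + 5 * q * q + + 5 * - q * - q ≡ + 0
    identity = solve-∀
  √5-Positive-asym (p-dominant (suc _ , refl) _ _) (both-nonneg (_ , ()) _ _)
  √5-Positive-asym {q = q} (p-dominant _ -q>0 _) (p-dominant _ q>0 _) =
    IsNat⁺-IsNat-sum≢0 -q>0 (IsNat⁺⇒IsNat q>0) (ℤP.+-inverseʳ (- q))
  √5-Positive-asym {p} {q} (p-dominant _ _ norm>0) (q-dominant _ _ norm′<0) =
    IsNat⁺-IsNat-sum≢0 norm>0 (IsNat⁺⇒IsNat norm′<0) (identity p q)
    where
    identity : ∀ p q → p * p - + 5 * q * q + (+ 5 * - q * - q - - p * - p) ≡ + 0
    identity = solve-∀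
  √5-Positive-asym {q = q} (q-dominant _ q>0 _) (both-nonneg _ -q≥0 _) =
    IsNat⁺-IsNat-sum≢0 q>0 -q≥0 (ℤP.+-inverseʳ q)
  √5-Positive-asym {p} {q} (q-dominant _ _ norm<0) (p-dominant _ _ norm′>0) =
    IsNat⁺-IsNat-sum≢0 norm<0 (IsNat⁺⇒IsNat norm′>0) (identity p q)
    where
    identity : ∀ p q → + 5 * q * q - p * p + (- p * - p - + 5 * - q * - q) ≡ + 0
    identity = solve-∀
  √5-Positive-asym {p} (q-dominant -p>0 _ _) (q-dominant p>0 _ _) =
    IsNat⁺-IsNat-sum≢0 -p>0 (IsNat⁺⇒IsNat p>0) (ℤP.+-inverseʳ (- p))

  NatCoords⁺⇒posᵇ : ∀ {x} → NatCoords⁺ x → T (posᵇ x)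
  NatCoords⁺⇒posᵇ (natCoords⁺ m n 1≤m+n) =
    √5-test-complete _ _ (both-nonneg (IsNat-+ (IsNat-* (2 , refl) (m , refl)) (n , refl)) (n , refl)
      (subst IsNat⁺ (identity (+ m) (+ n)) (IsNat⁺-+ (IsNat⁺-pos 1≤m+n) (m ℕ.+ n , refl))))
    where
    identity : ∀ m n → m + n + (m + n) ≡ + 2 * m + n + n
    identity = solve-∀

  posᵇ-timesφ⁻¹ : ∀ x → T (posᵇ (timesφ x)) → T (posᵇ x)
  posᵇ-timesφ⁻¹ x = √5-test-complete _ _ ∘ √5-Positive-timesφ⁻¹ (a x) (b x) ∘ √5-test-sound _ _

  Positive⇒posᵇ : ∀ {x} → Positive x → T (posᵇ x)
  Positive⇒posᵇ (n , h) = descend n (NatCoords⁺⇒posᵇ h)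
    where
    descend : ∀ n {x} → T (posᵇ (timesφ^ n x)) → T (posᵇ x)
    descend zero h = h
    descend (suc n) {x} h = descend n (posᵇ-timesφ⁻¹ (timesφ^ n x) h)

  posᵇ-asym : ∀ x → T (posᵇ x) → ¬ T (posᵇ (negφ x))
  posᵇ-asym x h h′ =
    √5-Positive-asym (√5-test-sound _ _ h) (subst (λ p → √5-Positive p (- b x)) (identity (a x) (b x)) (√5-test-sound _ _ h′))
    where
    identity : ∀ a b → + 2 * - a + - b ≡ - (+ 2 * a + b)
    identity = solve-∀

  posᵇ⇒Positive : ∀ {x} → T (posᵇ x) → Positive x
  posᵇ⇒Positive {x} h with trichotomy x
  ... | inj₁ x>0 = x>0
  ... | inj₂ (inj₁ refl) = ⊥-elim h
  ... | inj₂ (inj₂ -x>0) = ⊥-elim (posᵇ-asym x h (Positive⇒posᵇ -x>0))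

  <φ⇒Positive : ∀ {x y} → x <φ y → Positive (y -φ x)
  <φ⇒Positive = posᵇ⇒Positive

  Positive⇒<φ : ∀ {x y} → Positive (y -φ x) → x <φ y
  Positive⇒<φ = Positive⇒posᵇ

  <φ-by : ∀ {z} x y → z ≡ y -φ x → Positive z → x <φ y
  <φ-by x y z≡y-x z>0 = Positive⇒<φ {x} {y} (subst Positive z≡y-x z>0)

  <φ-asym : ∀ {x y} → x <φ y → ¬ y <φ x
  <φ-asym {x} {y} x<y y<x = posᵇ-asym (y -φ x) x<y (subst (T ∘ posᵇ) (sym (negφ-−φ x y)) y<x)

  ≤φ⇒NonNegative : ∀ {x y} → x ≤φ y → NonNegative (y -φ x)
  ≤φ⇒NonNegative {x} {y} x≤y with trichotomy (y -φ x)
  ... | inj₁ y-x>0 = inj₁ y-x>0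
  ... | inj₂ (inj₁ y-x≡0) = inj₂ y-x≡0
  ... | inj₂ (inj₂ x-y>0) = ⊥-elim (x≤y (Positive⇒<φ {y} {x} (subst Positive (negφ-−φ x y) x-y>0)))

  ιℕ-<φ⇒< : ∀ {m n} → ιℕ m <φ ιℕ n → m ℕ.< n
  ιℕ-<φ⇒< {m} {n} m<n with Positive-ι⇒IsNat⁺ (<φ⇒Positive {ιℕ m} {ιℕ n} m<n)
  ... | k , n-m≡1+k = subst (m ℕ.<_) (sym (ℤP.+-injective n≡m+1+k)) (ℕP.m<m+n m (s≤s z≤n))
    where
    n≡m+1+k : + n ≡ + (m ℕ.+ suc k)
    n≡m+1+k = trans (identity (+ m) (+ n)) (cong (λ z → + m + z) n-m≡1+k)
      where
      identity : ∀ m n → n ≡ m + (n - m)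
      identity = solve-∀

  window-step-up : ∀ {L U D₀ D₁} → D₀ <φ U → L <φ D₁ → D₁ -φ D₀ <φ U -φ L →
                   (L <φ D₀ × D₀ <φ U) ⊎ (L <φ D₁ × D₁ <φ U)
  window-step-up {L} {U} {D₀} {D₁} D₀<U L<D₁ step<width with T? (posᵇ (D₀ -φ L))
  ... | yes L<D₀ = inj₁ (L<D₀ , D₀<U)
  ... | no L≮D₀ = inj₂ (L<D₁ , Positive⇒<φ {D₁} {U} (subst Positive (sym (ℤφ-≡ (identity (a L) (a U) (a D₀) (a D₁)) (identity (b L) (b U) (b D₀) (b D₁))))
                                    (NonNegative-+φ-Positive (≤φ⇒NonNegative {D₀} {L} L≮D₀) (<φ⇒Positive {D₁ -φ D₀} {U -φ L} step<width))))
    where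
    identity : ∀ l u d₀ d₁ → u - d₁ ≡ l - d₀ + (u - l - (d₁ - d₀))
    identity = solve-∀

  window-step-down : ∀ {L U D₀ D₁} → L <φ D₀ → D₁ <φ U → D₀ -φ D₁ <φ U -φ L →
                     (L <φ D₀ × D₀ <φ U) ⊎ (L <φ D₁ × D₁ <φ U)
  window-step-down {L} {U} {D₀} {D₁} L<D₀ D₁<U step<width with T? (posᵇ (U -φ D₀))
  ... | yes D₀<U = inj₁ (L<D₀ , D₀<U)
  ... | no D₀≮U = inj₂ (Positive⇒<φ {L} {D₁} (subst Positive (sym (ℤφ-≡ (identity (a L) (a U) (a D₀) (a D₁)) (identity (b L) (b U) (b D₀) (b D₁))))
                                    (NonNegative-+φ-Positive (≤φ⇒NonNegative {U} {D₀} D₀≮U) (<φ⇒Positive {D₀ -φ D₁} {U -φ L} step<width))) , D₁<U)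
    where
    identity : ∀ l u d₀ d₁ → d₁ - l ≡ d₀ - u + (u - l - (d₀ - d₁))
    identity = solve-∀

  -- Negative powers of φ and Cassini's identity
  sign : ℕ → ℤ
  sign k = if isEven k then + 1 else - + 1

  sign-suc : ∀ k → sign (suc k) ≡ - sign k
  sign-suc zero = refl
  sign-suc (suc k) = trans (sym (ℤP.neg-involutive (sign k))) (cong -_ (sym (sign-suc k)))

  φ⁻^ : ℕ → ℤφ
  φ⁻^ k = sign k ·φ ⟨ + F (suc k) , - + F k ⟩

  timesφ-φ⁻^ : ∀ k → timesφ (φ⁻^ (suc k)) ≡ φ⁻^ k
  timesφ-φ⁻^ k rewrite sign-suc k = ℤφ-≡ (identityᵃ (sign k) (+ F (suc k))) (identityᵇ (sign k) (+ F (suc k)) (+ F k))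
    where
    identityᵃ : ∀ ε B → - ε * - B ≡ ε * B
    identityᵃ = solve-∀
    identityᵇ : ∀ ε B A → - ε * (B + A) + - ε * - B ≡ ε * - A
    identityᵇ = solve-∀

  timesφ^-φ⁻^ : ∀ k → timesφ^ k (φ⁻^ k) ≡ 1φ
  timesφ^-φ⁻^ zero = refl
  timesφ^-φ⁻^ (suc k) = begin
    timesφ (timesφ^ k (φ⁻^ (suc k)))  ≡⟨ timesφ^-commute timesφ (λ _ → refl) k (φ⁻^ (suc k)) ⟨
    timesφ^ k (timesφ (φ⁻^ (suc k)))  ≡⟨ cong (timesφ^ k) (timesφ-φ⁻^ k) ⟩
    timesφ^ k (φ⁻^ k)                 ≡⟨ timesφ^-φ⁻^ k ⟩
    1φ                                ∎
    where open ≡-Reasoning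

  Positive-φ⁻^ : ∀ k → Positive (φ⁻^ k)
  Positive-φ⁻^ k = Positive-timesφ^⁻¹ k (subst Positive (sym (timesφ^-φ⁻^ k)) (0 , natCoords⁺ 1 0 (s≤s z≤n)))

  rφ⁻ʰ<1 : ∀ r h → ιℕ r <φ φ^ h → Positive (1φ -φ + r ·φ φ⁻^ h)
  rφ⁻ʰ<1 r h r<φʰ = Positive-timesφ^⁻¹ h (subst Positive (sym scaled) (<φ⇒Positive {ιℕ r} {φ^ h} r<φʰ))
    where
    open ≡-Reasoning
    timesφ^-1φ : ∀ h → timesφ^ h 1φ ≡ φ^ h
    timesφ^-1φ zero = refl
    timesφ^-1φ (suc h) = cong timesφ (timesφ^-1φ h)
    scaled : timesφ^ h (1φ -φ + r ·φ φ⁻^ h) ≡ φ^ h -φ ιℕ r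
    scaled = begin
      timesφ^ h (1φ +φ negφ (+ r ·φ φ⁻^ h))             ≡⟨ timesφ^-+φ h 1φ (negφ (+ r ·φ φ⁻^ h)) ⟩
      timesφ^ h 1φ +φ timesφ^ h (negφ (+ r ·φ φ⁻^ h))   ≡⟨ cong₂ _+φ_ (timesφ^-1φ h) (timesφ^-negφ h (+ r ·φ φ⁻^ h)) ⟩
      φ^ h +φ negφ (timesφ^ h (+ r ·φ φ⁻^ h))           ≡⟨ cong (λ y → φ^ h +φ negφ y) (timesφ^-·φ (+ r) h (φ⁻^ h)) ⟩
      φ^ h +φ negφ (+ r ·φ timesφ^ h (φ⁻^ h))           ≡⟨ cong (λ y → φ^ h +φ negφ (+ r ·φ y)) (timesφ^-φ⁻^ h) ⟩
      φ^ h +φ negφ (+ r ·φ 1φ)                          ≡⟨ cong (λ y → φ^ h +φ negφ y) (ι≡·1φ (+ r)) ⟨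
      φ^ h -φ ιℕ r                                      ∎

  cassini : ∀ k → sign k * (+ F (suc k) * + F (suc k) - + F k * + F (2 ℕ.+ k)) ≡ + 1
  cassini zero = refl
  cassini (suc k) = begin
    sign (suc k) * (C * C - B * (C + B))  ≡⟨ cong (_* (C * C - B * (C + B))) (sign-suc k) ⟩
    - sign k * (C * C - B * (C + B))      ≡⟨ identity (sign k) A B ⟩
    sign k * (B * B - A * C)              ≡⟨ cassini k ⟩
    + 1                                   ∎
    where
    open ≡-Reasoning
    A B C : ℤ
    A = + F k
    B = + F (suc k)
    C = B + A
    identity : ∀ ε A B → - ε * ((B + A) * (B + A) - B * ((B + A) + B)) ≡ ε * (B * B - A * (B + A))
    identity = solve-∀

  cassini-parity : ∀ k {β} → isEven k ≡ β →
    (if β then + 1 else - + 1) * (+ F (suc k) * + F (suc k) - + F k * + F (2 ℕ.+ k)) ≡ + 1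
  cassini-parity k refl = cassini k

  by-cassini : ∀ {l r c : ℤ} x → l ≡ r + x * (c - + 1) → c ≡ + 1 → l ≡ r
  by-cassini {r = r} x l≡r+x*0 refl = trans l≡r+x*0 (trans (cong (λ z → r + z) (ℤP.*-zeroʳ x)) (ℤP.+-identityʳ r))

  F[2+h]φ⁻ʰ≡1+F[h]φ⁻⁽²⁺ʰ⁾ : ∀ h → + F (2 ℕ.+ h) ·φ φ⁻^ h ≡ 1φ +φ + F h ·φ φ⁻^ (2 ℕ.+ h)
  F[2+h]φ⁻ʰ≡1+F[h]φ⁻⁽²⁺ʰ⁾ h = ℤφ-≡ (by-cassini (+ 1) (identityᵃ (sign h) A B) (cassini h)) (identityᵇ (sign h) A B)
    where
    A B : ℤ
    A = + F h
    B = + F (suc h)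
    identityᵃ : ∀ ε A B → (B + A) * (ε * B) ≡ + 1 + A * (ε * ((B + A) + B)) + + 1 * (ε * (B * B - A * (B + A)) - + 1)
    identityᵃ = solve-∀
    identityᵇ : ∀ ε A B → (B + A) * (ε * - A) ≡ + 0 + A * (ε * - (B + A))
    identityᵇ = solve-∀

  wφ⁻⁽²⁺ʰ⁾<1 : ∀ h w → w ℕ.< F (2 ℕ.+ h) → Positive (1φ -φ + w ·φ φ⁻^ (2 ℕ.+ h))
  wφ⁻⁽²⁺ʰ⁾<1 h w w<C = subst Positive (sym (ℤφ-≡ (identity C (+ w) (a 1φ) (a β)) (identity C (+ w) (b 1φ) (b β))))
    (Positive-+φ-NonNegative
      (subst Positive (sym 1-Cβ≡Cφ⁻⁽³⁺ʰ⁾+Bβ) (Positive-+φ-NonNegative (Positive-·φ (IsNat⁺-pos (F-suc-pos (suc h))) (Positive-φ⁻^ (3 ℕ.+ h)))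
                                                        (NonNegative-·φ (F (suc h) , refl) (Positive-φ⁻^ (2 ℕ.+ h)))))
      (NonNegative-·φ (IsNat-∸ (ℕP.<⇒≤ w<C)) (Positive-φ⁻^ (2 ℕ.+ h))))
    where
    A B C : ℤ
    A = + F h
    B = + F (suc h)
    C = B + A
    β : ℤφ
    β = φ⁻^ (2 ℕ.+ h)
    1-Cβ≡Cφ⁻⁽³⁺ʰ⁾+Bβ : 1φ -φ C ·φ β ≡ C ·φ φ⁻^ (3 ℕ.+ h) +φ B ·φ β
    1-Cβ≡Cφ⁻⁽³⁺ʰ⁾+Bβ rewrite sign-suc h = ℤφ-≡ (by-cassini (- + 1) (identityᵃ (sign h) A B) (cassini h)) (identityᵇ (sign h) A B)
      where
      identityᵃ : ∀ ε A B → + 1 - (B + A) * (ε * ((B + A) + B))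
                    ≡ (B + A) * (- ε * (((B + A) + B) + (B + A))) + B * (ε * ((B + A) + B)) + - + 1 * (ε * (B * B - A * (B + A)) - + 1)
      identityᵃ = solve-∀
      identityᵇ : ∀ ε A B → + 0 - (B + A) * (ε * - (B + A)) ≡ (B + A) * (- ε * - ((B + A) + B)) + B * (ε * - (B + A))
      identityᵇ = solve-∀
    identity : ∀ c w e β → e - w * β ≡ e - c * β + (c - w) * β
    identity = solve-∀

  candidate-even : ∀ h → isEven h ≡ true → ∀ μ q →
    let A = + F h; B = + F (suc h); C = + F (2 ℕ.+ h); w = μ * B - q * C in
    C ·φ (w ·φ φ⁻¹ -φ ι (μ * A - q * B)) ≡ μ ·φ 1φ -φ w ·φ φ⁻^ (2 ℕ.+ h)
  candidate-even h even μ q rewrite even =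
    ℤφ-≡ (by-cassini μ (identityᵃ μ q (+ F h) (+ F (suc h))) (cassini-parity h even))
         (identityᵇ μ q (+ F h) (+ F (suc h)))
    where
    identityᵃ : ∀ μ q A B → (B + A) * ((μ * B - q * (B + A)) * - + 1 - (μ * A - q * B))
                          ≡ μ * + 1 - (μ * B - q * (B + A)) * (+ 1 * ((B + A) + B)) + μ * (+ 1 * (B * B - A * (B + A)) - + 1)
    identityᵃ = solve-∀
    identityᵇ : ∀ μ q A B → (B + A) * ((μ * B - q * (B + A)) * + 1 - + 0) ≡ μ * + 0 - (μ * B - q * (B + A)) * (+ 1 * - (B + A))
    identityᵇ = solve-∀

  candidate-odd : ∀ h → isEven h ≡ false → ∀ m q →
    let A = + F h; B = + F (suc h); C = + F (2 ℕ.+ h); w = m * A - q * C in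
    C ·φ (w ·φ φ⁻¹ -φ ι (m * (B - A) - q * B)) ≡ m ·φ 1φ +φ w ·φ φ⁻^ (2 ℕ.+ h)
  candidate-odd h odd m q rewrite odd =
    ℤφ-≡ (by-cassini m (identityᵃ m q (+ F h) (+ F (suc h))) (cassini-parity h odd))
         (identityᵇ m q (+ F h) (+ F (suc h)))
    where
    identityᵃ : ∀ m q A B → (B + A) * ((m * A - q * (B + A)) * - + 1 - (m * (B - A) - q * B))
                          ≡ m * + 1 + (m * A - q * (B + A)) * (- + 1 * ((B + A) + B)) + m * (- + 1 * (B * B - A * (B + A)) - + 1)
    identityᵃ = solve-∀
    identityᵇ : ∀ m q A B → (B + A) * ((m * A - q * (B + A)) * + 1 - + 0) ≡ m * + 0 + (m * A - q * (B + A)) * (- + 1 * - (B + A))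
    identityᵇ = solve-∀

  -- Hofstadter's G
  ¬T⇒≡false : ∀ {β : Bool} → ¬ T β → β ≡ false
  ¬T⇒≡false {false} _ = refl
  ¬T⇒≡false {true} ¬t = ⊥-elim (¬t _)

  T⇒≡true : ∀ {β : Bool} → T β → β ≡ true
  T⇒≡true {true} _ = refl

  greatestBelow-unique : ∀ P n m → m ℕ.≤ n → P m ≡ true → (∀ g → m ℕ.< g → P g ≡ false) → greatestBelow P n ≡ m
  greatestBelow-unique P zero .zero z≤n _ _ = refl
  greatestBelow-unique P (suc n) m m≤1+n Pm P>m with ℕP.m≤n⇒m<n∨m≡n m≤1+n
  ... | inj₂ refl rewrite Pm = refl
  ... | inj₁ m<1+n rewrite P>m (suc n) m<1+n = greatestBelow-unique P n m (ℕP.≤-pred m<1+n) Pm P>m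

  G-unique : ∀ v m → ιℕ m ≤φ + suc v ·φ φ⁻¹ → + suc v ·φ φ⁻¹ <φ ιℕ (suc m) → G v ≡ m
  G-unique v m m≤X X<1+m = greatestBelow-unique _ (suc v) m (ℕP.<⇒≤ m<1+v)
    (cong (λ β → if β then false else true) (¬T⇒≡false m≤X)) beyond
    where
    X : ℤφ
    X = + suc v ·φ φ⁻¹
    X<1+v : X <φ ιℕ (suc v)
    X<1+v = Positive⇒<φ {X} {ιℕ (suc v)} (subst Positive (ℤφ-≡ (identityᵃ (+ suc v)) (identityᵇ (+ suc v))) (Positive-·φ (v , refl) (Positive-φ⁻^ 2)))
      where
      identityᵃ : ∀ V → V * + 2 ≡ V - V * - + 1
      identityᵃ = solve-∀
      identityᵇ : ∀ V → V * - + 1 ≡ + 0 - V * + 1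
      identityᵇ = solve-∀
    m<1+v : m ℕ.< suc v
    m<1+v = ιℕ-<φ⇒< (Positive⇒<φ {ιℕ m} {ιℕ (suc v)}
      (subst Positive (ℤφ-≡ (identity (+ m) (a X) (+ suc v)) (identity (+ 0) (b X) (+ 0)))
        (NonNegative-+φ-Positive (≤φ⇒NonNegative {ιℕ m} {X} m≤X) (<φ⇒Positive {X} {ιℕ (suc v)} X<1+v))))
      where
      identity : ∀ m x v → x - m + (v - x) ≡ v - m
      identity = solve-∀
    beyond : ∀ g → m ℕ.< g → (if posᵇ (ιℕ g -φ X) then false else true) ≡ false
    beyond g m<g = cong (λ β → if β then false else true) (T⇒≡true (Positive⇒posᵇ
      (subst Positive (ℤφ-≡ (identity (+ suc m) (a X) (+ g)) (identity (+ 0) (b X) (+ 0)))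
        (Positive-+φ-NonNegative (<φ⇒Positive {X} {ιℕ (suc m)} X<1+m) (NonNegative-ι (IsNat-∸ m<g))))))
      where
      identity : ∀ m x g → m - x + (g - m) ≡ g - x
      identity = solve-∀

  G-between : ∀ v M → Positive (+ suc v ·φ φ⁻¹ -φ ι M) → Positive (ι (M + + 1) -φ + suc v ·φ φ⁻¹) →
              Σ ℕ λ m → M ≡ + m × G v ≡ m
  G-between v M M<X X<M+1 = m , M≡m ,
    G-unique v m (<φ-asym {ιℕ m} {X} (Positive⇒<φ {ιℕ m} {X} (subst (λ z → Positive (X -φ ι z)) M≡m M<X)))
                 (Positive⇒<φ {X} {ιℕ (suc m)} (subst (λ z → Positive (ι z -φ X)) M+1≡1+m X<M+1))
    where
    X : ℤφ
    X = + suc v ·φ φ⁻¹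
    M≥0 : IsNat M
    M≥0 = IsNat⁺[x+1]⇒IsNat (Positive-ι⇒IsNat⁺ (subst Positive (ℤφ-≡ (cancel (M + + 1) (a X)) (cancel (+ 0) (b X)))
                                                     (Positive-+φ X<M+1 (Positive-·φ (v , refl) (Positive-φ⁻^ 1)))))
      where
      cancel : ∀ x y → x - y + y ≡ x
      cancel = solve-∀
    m : ℕ
    m = proj₁ M≥0
    M≡m : M ≡ + m
    M≡m = proj₂ M≥0
    M+1≡1+m : M + + 1 ≡ + suc m
    M+1≡1+m = trans (cong (_+ + 1) M≡m) (cong +_ (ℕP.+-comm m 1))

  -- r(wφ⁻¹ - n) - Γ = (v + 1)φ⁻¹ - M  for  v = wr + t  and  M = s + (n - k)r
  LowCond⇒G-window : ∀ r s t k w (low : LowCond r (rγ r s t k) w) →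
    let M = + s + (proj₁ low - k) * + r; X = + suc (w ℕ.* r ℕ.+ t) ·φ φ⁻¹ in
    Positive (X -φ ι M) × Positive (ι (M + + 1) -φ X)
  LowCond⇒G-window r s t k w (n , above , below) =
    subst Positive
      (ℤφ-≡ (trans (belowᵃ (+ r) (+ w) (+ s) (+ t) k n) (cong (λ V → V * - + 1 - M) (sym 1+v≡)))
            (trans (belowᵇ (+ r) (+ w) (+ t)) (cong (λ V → V * + 1 - + 0) (sym 1+v≡))))
      (<φ⇒Positive {rγ r s t k} {+ r ·φ (+ w ·φ φ⁻¹ -φ ι n)} above) ,
    subst Positive
      (ℤφ-≡ (trans (aboveᵃ (+ r) (+ w) (+ s) (+ t) k n) (cong (λ V → M + + 1 - V * - + 1) (sym 1+v≡)))
            (trans (aboveᵇ (+ r) (+ w) (+ t)) (cong (λ V → + 0 - V * + 1) (sym 1+v≡))))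
      (<φ⇒Positive {+ r ·φ (+ w ·φ φ⁻¹ -φ ι n)} {rγ r s t k +φ ι (+ 1)} below)
    where
    M : ℤ
    M = + s + (n - k) * + r
    1+v≡ : + suc (w ℕ.* r ℕ.+ t) ≡ + 1 + + w * + r + + t
    1+v≡ = cong (λ z → + 1 + z + + t) (ℤP.pos-* w r)
    belowᵃ : ∀ r w s t k n → r * (w * - + 1 - n) - ((s - (+ 1 + t) * - + 1) - k * r)
                           ≡ (+ 1 + w * r + t) * - + 1 - (s + (n - k) * r)
    belowᵃ = solve-∀
    belowᵇ : ∀ r w t → r * (w * + 1 - + 0) - ((+ 0 - (+ 1 + t) * + 1) - + 0) ≡ (+ 1 + w * r + t) * + 1 - + 0
    belowᵇ = solve-∀
    aboveᵃ : ∀ r w s t k n → ((s - (+ 1 + t) * - + 1) - k * r) + + 1 - r * (w * - + 1 - n)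
                           ≡ s + (n - k) * r + + 1 - (+ 1 + w * r + t) * - + 1
    aboveᵃ = solve-∀
    aboveᵇ : ∀ r w t → ((+ 0 - (+ 1 + t) * + 1) - + 0) + + 0 - r * (w * + 1 - + 0) ≡ + 0 - (+ 1 + w * r + t) * + 1
    aboveᵇ = solve-∀

  LowCond⇒Conclusion : ∀ r s t k w .{{_ : NonZero r}} → s ℕ.< r → LowCond r (rγ r s t k) w → Conclusion r s t w
  LowCond⇒Conclusion r s t k w s<r low = G-mod , v-mod , refl
    where
    n : ℤ
    n = proj₁ low
    between : Σ ℕ λ m → + s + (n - k) * + r ≡ + m × G (w ℕ.* r ℕ.+ t) ≡ m
    between = G-between (w ℕ.* r ℕ.+ t) (+ s + (n - k) * + r)
                (proj₁ (LowCond⇒G-window r s t k w low)) (proj₂ (LowCond⇒G-window r s t k w low))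
    m : ℕ
    m = proj₁ between
    M≡m : + s + (n - k) * + r ≡ + m
    M≡m = proj₁ (proj₂ between)
    n-k≥0 : IsNat (n - k)
    n-k≥0 with IsNat⊎IsNat⁺-neg (n - k)
    ... | inj₁ n-k≥0 = n-k≥0
    ... | inj₂ k-n>0 = ⊥-elim (IsNat⁺-IsNat-sum≢0 (IsNat⁺-+ (IsNat⁺-∸ s<r) (IsNat-* (IsNat⁺⇒IsNat[x-1] k-n>0) (r , refl)))
                                                   (m , M≡m) (identity (+ r) (+ s) (n - k)))
      where
      identity : ∀ r s x → r - s + (- x - + 1) * r + (s + x * r) ≡ + 0
      identity = solve-∀
    d : ℕ
    d = proj₁ n-k≥0
    m≡s+dr : m ≡ s ℕ.+ d ℕ.* r
    m≡s+dr = ℤP.+-injective (begin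
      + m                  ≡⟨ M≡m ⟨
      + s + (n - k) * + r  ≡⟨ cong (λ z → + s + z * + r) (proj₂ n-k≥0) ⟩
      + s + + d * + r      ≡⟨ cong (λ z → + s + z) (ℤP.pos-* d r) ⟨
      + (s ℕ.+ d ℕ.* r)    ∎)
      where open ≡-Reasoning
    G-mod : G (w ℕ.* r ℕ.+ t) ℕ.% r ≡ s ℕ.% r
    G-mod = trans (cong (ℕ._% r) (trans (proj₂ (proj₂ between)) m≡s+dr)) (ℕD.[m+kn]%n≡m%n s d r)
    v-mod : (w ℕ.* r ℕ.+ t) ℕ.% r ≡ t ℕ.% r
    v-mod = trans (cong (ℕ._% r) (ℕP.+-comm (w ℕ.* r) t)) (ℕD.[m+kn]%n≡m%n t w r)

  window⇒LowCond : ∀ {r w C Γ Y} n → IsNat⁺ C → C ·φ (+ w ·φ φ⁻¹ -φ ι n) ≡ Y →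
                   C ·φ Γ <φ + r ·φ Y → + r ·φ Y <φ C ·φ Γ +φ C ·φ 1φ → LowCond r Γ w
  window⇒LowCond {r} {w} {C} {Γ} n C>0 refl CΓ<rY rY<CΓ+C =
    n , Positive⇒<φ {Γ} {+ r ·φ x} (Positive-·φ⁻¹ C>0 (subst Positive (ℤφ-≡ (lowerᵢ (+ r) C (a x) (a Γ)) (lowerᵢ (+ r) C (b x) (b Γ)))
                                                      (<φ⇒Positive {C ·φ Γ} {+ r ·φ (C ·φ x)} CΓ<rY)))
      , Positive⇒<φ {+ r ·φ x} {Γ +φ 1φ} (Positive-·φ⁻¹ C>0 (subst Positive (ℤφ-≡ (upperᵢ (+ r) C (a x) (a Γ) (a 1φ)) (upperᵢ (+ r) C (b x) (b Γ) (b 1φ)))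
                                                      (<φ⇒Positive {+ r ·φ (C ·φ x)} {C ·φ Γ +φ C ·φ 1φ} rY<CΓ+C)))
    where
    x : ℤφ
    x = + w ·φ φ⁻¹ -φ ι n
    lowerᵢ : ∀ r C x g → r * (C * x) - C * g ≡ C * (r * x - g)
    lowerᵢ = solve-∀
    upperᵢ : ∀ r C x g e → C * g + C * e - r * (C * x) ≡ C * (g + e - r * x)
    upperᵢ = solve-∀

  module NextCandidate {r h : ℕ} {Γ : ℤφ} {j : ℤ} (0<r : 0 ℕ.< r) (r<φʰ : ιℕ r <φ φ^ h)
           (lower : ι ((j - + 1) * + r) <φ + F (2 ℕ.+ h) ·φ Γ)
           (upper : + F (2 ℕ.+ h) ·φ Γ ≤φ ι (j * + r)) where

    private
      A B C R : ℤ
      A = + F h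
      B = + F (suc h)
      C = + F (2 ℕ.+ h)
      R = + r
      β : ℤφ
      β = φ⁻^ (2 ℕ.+ h)
      L U : ℤφ
      L = C ·φ Γ
      U = C ·φ Γ +φ C ·φ 1φ

      β>0 : Positive β
      β>0 = Positive-φ⁻^ (2 ℕ.+ h)

      C>0 : IsNat⁺ C
      C>0 = IsNat⁺-pos (F-suc-pos (suc h))
      R>0 : IsNat⁺ R
      R>0 = IsNat⁺-pos 0<r

      CΓ>[j-1]r : Positive (L -φ ((j - + 1) * R) ·φ 1φ)
      CΓ>[j-1]r = subst (λ y → Positive (L -φ y)) (ι≡·1φ ((j - + 1) * R)) (<φ⇒Positive {ι ((j - + 1) * R)} {L} lower)

      jr≥CΓ : NonNegative ((j * R) ·φ 1φ -φ L)
      jr≥CΓ = subst (λ y → NonNegative (y -φ L)) (ι≡·1φ (j * R)) (≤φ⇒NonNegative {L} {ι (j * R)} upper)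

      margin : Positive ((C - R) ·φ 1φ -φ (R * A) ·φ β)
      margin = subst Positive scaled (Positive-·φ C>0 (rφ⁻ʰ<1 r h r<φʰ))
        where
        open ≡-Reasoning
        scaled : C ·φ (1φ -φ R ·φ φ⁻^ h) ≡ (C - R) ·φ 1φ -φ (R * A) ·φ β
        scaled = begin
          C ·φ (1φ -φ R ·φ φ⁻^ h)              ≡⟨ ℤφ-≡ (distribute C R (a 1φ) (a (φ⁻^ h))) (distribute C R (b 1φ) (b (φ⁻^ h))) ⟩
          C ·φ 1φ -φ R ·φ (C ·φ φ⁻^ h)         ≡⟨ cong (λ y → C ·φ 1φ -φ R ·φ y) (F[2+h]φ⁻ʰ≡1+F[h]φ⁻⁽²⁺ʰ⁾ h) ⟩
          C ·φ 1φ -φ R ·φ (1φ +φ A ·φ β)       ≡⟨ ℤφ-≡ (collect C R A (a 1φ) (a β)) (collect C R A (b 1φ) (b β)) ⟩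
          (C - R) ·φ 1φ -φ (R * A) ·φ β        ∎
          where
          distribute : ∀ C R e ψ → C * (e - R * ψ) ≡ C * e - R * (C * ψ)
          distribute = solve-∀
          collect : ∀ C R A e β → C * e - R * (e + A * β) ≡ (C - R) * e - R * A * β
          collect = solve-∀

      quot : ℤ → ℤ
      quot x = (x ℤD./ℕ F (2 ℕ.+ h)) {{F-ss-nonZero {h}}}

      mod≡ : ∀ x → + modF h x ≡ x - quot x * C
      mod≡ x = trans (sym (cancel (+ modF h x) (quot x * C)))
                 (cong (_- quot x * C) (sym (ℤD.a≡a%ℕn+[a/ℕn]*n x (F (2 ℕ.+ h)) {{F-ss-nonZero {h}}})))
        where
        cancel : ∀ w y → w + y - y ≡ w
        cancel = solve-∀

      mod<F : ∀ x → modF h x ℕ.< F (2 ℕ.+ h)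
      mod<F x = ℤD.n%ℕd<d x (F (2 ℕ.+ h)) {{F-ss-nonZero {h}}}

      mod<C : ∀ x → IsNat⁺ (C - + modF h x)
      mod<C x = IsNat⁺-∸ (mod<F x)

      residue-gap : ∀ x y e → A + y - x ≡ C * e → IsNat (A + + modF h y - + modF h x)
      residue-gap x y e A+y-x≡Ce = IsNat-multiple (F (2 ℕ.+ h) , refl) multiple
        (subst IsNat⁺ (rearrange A (+ modF h x) (+ modF h y) C) (IsNat⁺-+ (mod<C x) (IsNat-+ (F h , refl) (modF h y , refl))))
        where
        open ≡-Reasoning
        multiple : C * (e + quot x - quot y) ≡ A + + modF h y - + modF h x
        multiple = begin
          C * (e + quot x - quot y)                          ≡⟨ split C e (quot x) (quot y) ⟩
          C * e + C * (quot x - quot y)                      ≡⟨ cong (_+ C * (quot x - quot y)) A+y-x≡Ce ⟨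
          A + y - x + C * (quot x - quot y)                  ≡⟨ regroup A C x y (quot x) (quot y) ⟩
          A + (y - quot y * C) - (x - quot x * C)            ≡⟨ cong₂ (λ u v → A + u - v) (mod≡ y) (mod≡ x) ⟨
          A + + modF h y - + modF h x                        ∎
          where
          split : ∀ C e u v → C * (e + u - v) ≡ C * e + C * (u - v)
          split = solve-∀
          regroup : ∀ A C x y u v → A + y - x + C * (u - v) ≡ A + (y - v * C) - (x - u * C)
          regroup = solve-∀
        rearrange : ∀ A W₀ W₁ C → C - W₀ + (A + W₁) ≡ A + W₁ - W₀ + C
        rearrange = solve-∀

      even-window⇒LowCond : isEven h ≡ true → ∀ μ → let Y = μ ·φ 1φ -φ + modF h (μ * B) ·φ β in
                            L <φ R ·φ Y × R ·φ Y <φ U → LowCond r Γ (modF h (μ * B))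
      even-window⇒LowCond even μ (L<D , D<U) =
        window⇒LowCond {r} {modF h (μ * B)} {C} {Γ} (μ * A - quot (μ * B) * B) C>0 candidate L<D D<U
        where
        candidate : C ·φ (+ modF h (μ * B) ·φ φ⁻¹ -φ ι (μ * A - quot (μ * B) * B)) ≡ μ ·φ 1φ -φ + modF h (μ * B) ·φ β
        candidate = subst (λ w → C ·φ (w ·φ φ⁻¹ -φ ι (μ * A - quot (μ * B) * B)) ≡ μ ·φ 1φ -φ w ·φ β)
                          (sym (mod≡ (μ * B))) (candidate-even h even μ (quot (μ * B)))

      odd-window⇒LowCond : isEven h ≡ false → ∀ m → let Y = m ·φ 1φ +φ + modF h (m * A) ·φ β in
                           L <φ R ·φ Y × R ·φ Y <φ U → LowCond r Γ (modF h (m * A))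
      odd-window⇒LowCond odd m (L<D , D<U) =
        window⇒LowCond {r} {modF h (m * A)} {C} {Γ} (m * (B - A) - quot (m * A) * B) C>0 candidate L<D D<U
        where
        candidate : C ·φ (+ modF h (m * A) ·φ φ⁻¹ -φ ι (m * (B - A) - quot (m * A) * B)) ≡ m ·φ 1φ +φ + modF h (m * A) ·φ β
        candidate = subst (λ w → C ·φ (w ·φ φ⁻¹ -φ ι (m * (B - A) - quot (m * A) * B)) ≡ m ·φ 1φ +φ w ·φ β)
                          (sym (mod≡ (m * A))) (candidate-odd h odd m (quot (m * A)))

      even-case : isEven h ≡ true → ¬ LowCond r Γ (modF h (j * B)) → LowCond r Γ (modF h ((j + + 1) * B))
      even-case even ¬low₀ =
        [ ⊥-elim ∘ ¬low₀ ∘ even-window⇒LowCond even j , even-window⇒LowCond even (j + + 1) ]′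
          (window-step-up {L} {U} {R ·φ Y₀} {R ·φ Y₁} D₀<U L<D₁ step<width)
        where
        W₀ W₁ : ℤ
        W₀ = + modF h (j * B)
        W₁ = + modF h ((j + + 1) * B)
        Y₀ Y₁ : ℤφ
        Y₀ = j ·φ 1φ -φ W₀ ·φ β
        Y₁ = (j + + 1) ·φ 1φ -φ W₁ ·φ β
        D₀<U : R ·φ Y₀ <φ U
        D₀<U = <φ-by (R ·φ Y₀) U
          (ℤφ-≡ (decomposition C R j A W₀ (a Γ) (a 1φ) (a β)) (decomposition C R j A W₀ (b Γ) (b 1φ) (b β)))
          (Positive-+φ-NonNegative (Positive-+φ-NonNegative (Positive-+φ CΓ>[j-1]r margin)
                                                            (NonNegative-·φ (IsNat-* (r , refl) (F h , refl)) β>0))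
                                   (NonNegative-·φ (IsNat-* (r , refl) (modF h (j * B) , refl)) β>0))
          where
          decomposition : ∀ C R j A W g e β → C * g - (j - + 1) * R * e + ((C - R) * e - R * A * β) + R * A * β + R * W * β
                                            ≡ C * g + C * e - R * (j * e - W * β)
          decomposition = solve-∀
        L<D₁ : L <φ R ·φ Y₁
        L<D₁ = <φ-by L (R ·φ Y₁)
          (ℤφ-≡ (decomposition C R j W₁ (a Γ) (a 1φ) (a β)) (decomposition C R j W₁ (b Γ) (b 1φ) (b β)))
          (NonNegative-+φ-Positive jr≥CΓ (Positive-·φ R>0 (wφ⁻⁽²⁺ʰ⁾<1 h _ (mod<F ((j + + 1) * B)))))
          where
          decomposition : ∀ C R j W g e β → j * R * e - C * g + R * (e - W * β) ≡ R * ((j + + 1) * e - W * β) - C * g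
          decomposition = solve-∀
        step<width : R ·φ Y₁ -φ R ·φ Y₀ <φ U -φ L
        step<width = <φ-by (R ·φ Y₁ -φ R ·φ Y₀) (U -φ L)
          (ℤφ-≡ (decomposition C R j A W₀ W₁ (a Γ) (a 1φ) (a β)) (decomposition C R j A W₀ W₁ (b Γ) (b 1φ) (b β)))
          (Positive-+φ-NonNegative margin (NonNegative-·φ (IsNat-* (r , refl) (residue-gap (j * B) ((j + + 1) * B) (+ 1) (gap A B j))) β>0))
          where
          decomposition : ∀ C R j A W₀ W₁ g e β → (C - R) * e - R * A * β + R * (A + W₁ - W₀) * β
                                                ≡ C * g + C * e - C * g - (R * ((j + + 1) * e - W₁ * β) - R * (j * e - W₀ * β))
          decomposition = solve-∀
          gap : ∀ A B j → A + (j + + 1) * B - j * B ≡ (B + A) * + 1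
          gap = solve-∀

      odd-case : isEven h ≡ false → b Γ ≢ + 0 → ¬ LowCond r Γ (modF h (j * A)) → LowCond r Γ (modF h ((j - + 1) * A))
      odd-case odd irrational ¬low₀ =
        [ ⊥-elim ∘ ¬low₀ ∘ odd-window⇒LowCond odd j , odd-window⇒LowCond odd (j - + 1) ]′
          (window-step-down {L} {U} {R ·φ Y₀} {R ·φ Y₁} L<D₀ D₁<U step<width)
        where
        W₀ W₁ : ℤ
        W₀ = + modF h (j * A)
        W₁ = + modF h ((j - + 1) * A)
        Y₀ Y₁ : ℤφ
        Y₀ = j ·φ 1φ +φ W₀ ·φ β
        Y₁ = (j - + 1) ·φ 1φ +φ W₁ ·φ β
        jr>CΓ : Positive ((j * R) ·φ 1φ -φ L)
        jr>CΓ with jr≥CΓ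
        ... | inj₁ jr>CΓ = jr>CΓ
        ... | inj₂ jr≡CΓ = ⊥-elim (irrational (ℤP.*-cancelˡ-≡ C (b Γ) (+ 0) {{F-ss-nonZero {h}}}
                                                (trans (identity (j * R) C (b Γ)) (trans (cong (-_ ∘ b) jr≡CΓ) (sym (ℤP.*-zeroʳ C))))))
          where
          identity : ∀ x c y → c * y ≡ - (x * + 0 - c * y)
          identity = solve-∀
        L<D₀ : L <φ R ·φ Y₀
        L<D₀ = <φ-by L (R ·φ Y₀)
          (ℤφ-≡ (decomposition C R j W₀ (a Γ) (a 1φ) (a β)) (decomposition C R j W₀ (b Γ) (b 1φ) (b β)))
          (Positive-+φ-NonNegative jr>CΓ (NonNegative-·φ (IsNat-* (r , refl) (modF h (j * A) , refl)) β>0))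
          where
          decomposition : ∀ C R j W g e β → j * R * e - C * g + R * W * β ≡ R * (j * e + W * β) - C * g
          decomposition = solve-∀
        D₁<U : R ·φ Y₁ <φ U
        D₁<U = <φ-by (R ·φ Y₁) U
          (ℤφ-≡ (decomposition C R j A W₁ (a Γ) (a 1φ) (a β)) (decomposition C R j A W₁ (b Γ) (b 1φ) (b β)))
          (Positive-+φ (Positive-+φ-NonNegative (Positive-+φ CΓ>[j-1]r margin) (NonNegative-·φ (IsNat-* (r , refl) (F h , refl)) β>0))
                       (Positive-·φ R>0 (wφ⁻⁽²⁺ʰ⁾<1 h _ (mod<F ((j - + 1) * A)))))
          where
          decomposition : ∀ C R j A W g e β → C * g - (j - + 1) * R * e + ((C - R) * e - R * A * β) + R * A * β + R * (e - W * β)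
                                            ≡ C * g + C * e - R * ((j - + 1) * e + W * β)
          decomposition = solve-∀
        step<width : R ·φ Y₀ -φ R ·φ Y₁ <φ U -φ L
        step<width = <φ-by (R ·φ Y₀ -φ R ·φ Y₁) (U -φ L)
          (ℤφ-≡ (decomposition C R j A W₀ W₁ (a Γ) (a 1φ) (a β)) (decomposition C R j A W₀ W₁ (b Γ) (b 1φ) (b β)))
          (Positive-+φ-NonNegative margin (NonNegative-·φ (IsNat-* (r , refl) (residue-gap (j * A) ((j - + 1) * A) (+ 0) (gap A B j))) β>0))
          where
          decomposition : ∀ C R j A W₀ W₁ g e β → (C - R) * e - R * A * β + R * (A + W₁ - W₀) * β
                                                ≡ C * g + C * e - C * g - (R * (j * e + W₀ * β) - R * ((j - + 1) * e + W₁ * β))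
          decomposition = solve-∀
          gap : ∀ A B j → A + (j - + 1) * A - j * A ≡ (B + A) * + 0
          gap = solve-∀

    next-candidate : b Γ ≢ + 0 → ¬ LowCond r Γ (wL h j) → LowCond r Γ (wH h j)
    next-candidate irrational with isEven h in parity
    ... | true = even-case parity
    ... | false = odd-case parity irrational

open import Data.Nat using (ℕ; NonZero; _≤_; _<_; _+_; s≤s; z≤n)
open import Data.Nat.Properties using (≤-trans)
open import Data.Integer using (ℤ; +_; _-_; _*_)
open import Data.Product using (_×_; _,_)
open import Function using (_∘_)
open import Relation.Nullary using (¬_)

theorem3 : (r s t : ℕ) .{{_ : NonZero r}} → s < r → t < r →
    (h : ℕ) → 1 ≤ h → ιℕ r <φ φ^ h → (∀ h′ → 1 ≤ h′ → h′ < h → ¬ (ιℕ r <φ φ^ h′)) →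
    (k : ℤ) → ι (+ 0) ≤φ rγ r s t k → rγ r s t k <φ ιℕ r →
    (j : ℤ) → ι ((j - + 1) * + r) <φ (+ F (2 + h)) ·φ rγ r s t k →
    (+ F (2 + h)) ·φ rγ r s t k ≤φ ι (j * + r) →
    (LowCond r (rγ r s t k) (wL h j) → Conclusion r s t (wL h j))
    × (¬ LowCond r (rγ r s t k) (wL h j) → Conclusion r s t (wH h j))
theorem3 r s t s<r _ h _ r<φʰ _ k _ _ j lower upper =
  LowCond⇒Conclusion r s t k (wL h j) s<r ,
  LowCond⇒Conclusion r s t k (wH h j) s<r ∘ NextCandidate.next-candidate {r} {h} {rγ r s t k} {j} (≤-trans (s≤s z≤n) s<r) r<φʰ lower upper λ ()
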